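{- Let $V$ be a finite set and $\mathcal{A},\mathcal{B}\subseteq 2^V$ hypergraphs on $V$. Then the family of inclusion-minimal sets $B\subseteq\mathcal{B}$ with $f(B)=1$ equals $tr\left(\bigcup_{A\in\mathcal{A}} tr(\mathcal{H}_A)\right)$.
   Context: For $x\in V$, $\mathcal{B}_x=\{b\in\mathcal{B}: x\in b\}$. For $B\subseteq\mathcal{B}$, $S_B=\{x\in V:\mathcal{B}_x\subseteq B\}$, and $f(B)=1$ if $S_B$ meets every hyperedge of $\mathcal{A}$, $f(B)=0$ otherwise. For $A\in\mathcal{A}$, $\mathcal{H}_A$ is the hypergraph with vertex set $\bigcup_{x\in A}\mathcal{B}_x\subseteq\mathcal{B}$ and hyperedge set $\{\mathcal{B}_x: x\in A\}$. For a hypergraph $\mathcal{H}$, a transversal is a set of vertices meeting every hyperedge, and $tr(\mathcal{H})$ is the hypergraph of inclusion-minimal transversals of $\mathcal{H}$. The union $\bigcup_{A\in\mathcal{A}} tr(\mathcal{H}_A)$ is viewed as a hypergraph on the vertex set $\mathcal{B}$. -}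

module Defs where

open import Data.Nat using (ℕ)
open import Data.Fin using (Fin)
open import Data.Fin.Subset using (Subset; _∈_; _⊆_)
open import Data.Vec using (tabulate; lookup)
open import Data.Product using (Σ; ∃; _×_)
open import Relation.Binary.PropositionalEquality using (_≡_)
open import Level using (0ℓ; suc)

Hypergraph : ℕ → Set₁
Hypergraph m = Subset m → Set

Transversal : {m : ℕ} → Hypergraph m → Subset m → Set
Transversal H T = ∀ e → H e → ∃ λ j → j ∈ e × j ∈ T

Minimal : {m : ℕ} → (Subset m → Set) → Subset m → Set
Minimal P T = P T × (∀ T' → T' ⊆ T → P T' → T ⊆ T')

tr : {m : ℕ} → Hypergraph m → Hypergraph m
tr H = Minimal (Transversal H)

-- Setting: V = Fin n; 𝓑 = {ℬ j : j : Fin m}, a hypergraph on V given by an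
-- (injective) enumeration of its hyperedges; subsets B ⊆ 𝓑 are Subset m.

-- 𝓑_x = { b ∈ 𝓑 : x ∈ b }, as a subset of the index set Fin m.
𝓑at : {n m : ℕ} → (Fin m → Subset n) → Fin n → Subset m
𝓑at ℬ x = tabulate (λ j → lookup (ℬ j) x)

-- x ∈ S_B  iff  𝓑_x ⊆ B.
InS : {n m : ℕ} → (Fin m → Subset n) → Subset m → Fin n → Set
InS ℬ B x = 𝓑at ℬ x ⊆ B

-- f(B) = 1 : S_B meets every hyperedge of 𝒜 (𝒜 given by enumeration 𝒜 i, i : Fin k).
fHolds : {n m k : ℕ} → (Fin k → Subset n) → (Fin m → Subset n) → Subset m → Set
fHolds 𝒜 ℬ B = ∀ i → ∃ λ x → x ∈ 𝒜 i × InS ℬ B x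

ℋ : {n m : ℕ} → (Fin m → Subset n) → Subset n → Hypergraph m
ℋ ℬ A e = ∃ λ x → x ∈ A × e ≡ 𝓑at ℬ x

⋃trℋ : {n m k : ℕ} → (Fin k → Subset n) → (Fin m → Subset n) → Hypergraph m
⋃trℋ 𝒜 ℬ e = ∃ λ i → tr (ℋ ℬ (𝒜 i)) e

{-# OPTIONS --safe #-}
module Submission where

-- f(B) = 1 says that for every A ∈ 𝒜 the set B contains a hyperedge 𝓑_x of ℋ_A. By blocker
-- duality this holds iff B meets every minimal transversal of ℋ_A: if B contains no hyperedge,
-- its complement is a transversal and so contains a minimal one that B misses. Hence f(B) = 1
-- iff B is a transversal of ⋃ tr(ℋ_A), and the minimal such B coincide.

open import Defs
open import Data.Nat using (ℕ)
open import Data.Fin using (Fin)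
open import Data.Fin.Subset using (Subset; _∈_; _∉_; _⊆_; _⊂_; _-_; ∁)
open import Data.Fin.Subset.Properties
  using (_∈?_; _⊆?_; ⊆-trans; p⊂q⇒p⊆q; x∈p⇒p-x⊂p; x∈p∧x≢y⇒x∈p-y; x∈∁p⇒x∉p; x∉p⇒x∈∁p)
open import Data.Fin.Subset.Induction using (Acc; acc; ⊂-wellFounded)
open import Data.Fin.Properties using (any?; all?)
open import Data.Product using (∃; _×_; _,_)
open import Data.Empty using (⊥-elim)
open import Relation.Nullary using (Dec; yes; no; ¬_; ¬?; contradiction)
open import Relation.Nullary.Decidable using (_×-dec_; _→-dec_; map′; decidable-stable)
open import Function.Definitions using (Injective)
open import Function.Bundles using (_⇔_; mk⇔; Equivalence)
open import Relation.Binary.PropositionalEquality using (_≡_; refl)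

open Equivalence using (to; from)

private
  variable
    n m k : ℕ

⊈⇒∃∈∉ : {p q : Subset n} → ¬ p ⊆ q → ∃ λ x → x ∈ p × x ∉ q
⊈⇒∃∈∉ {p = p} {q} p⊈q with any? (λ x → x ∈? p ×-dec ¬? (x ∈? q))
... | yes witness = witness
... | no ∄witness = ⊥-elim (p⊈q p⊆q)
  where
  p⊆q : p ⊆ q
  p⊆q {x} x∈p = decidable-stable (x ∈? q) (λ x∉q → ∄witness (x , x∈p , x∉q))

p⊆q∧x∉p⇒p⊆q-x : {p q : Subset n} {x : Fin n} → p ⊆ q → x ∉ p → p ⊆ q - x
p⊆q∧x∉p⇒p⊆q-x p⊆q x∉p y∈p = x∈p∧x≢y⇒x∈p-y (p⊆q y∈p) λ { refl → x∉p y∈p }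

Minimal-resp-⇔ : {P Q : Subset m → Set} → (∀ {T} → P T ⇔ Q T) → ∀ {T} → Minimal P T ⇔ Minimal Q T
Minimal-resp-⇔ P⇔Q = mk⇔
  (λ (pT , minP) → to P⇔Q pT , λ T' T'⊆T qT' → minP T' T'⊆T (from P⇔Q qT'))
  (λ (qT , minQ) → from P⇔Q qT , λ T' T'⊆T pT' → minQ T' T'⊆T (to P⇔Q pT'))

module _ {P : Subset m → Set} (P? : ∀ T → Dec (P T)) (P-mono : ∀ {T T'} → T ⊆ T' → P T → P T') where

  -- Since P is upward closed, a set none of whose one-point deletions satisfies P is minimal.
  minimal-below : ∀ C → P C → ∃ λ T → T ⊆ C × Minimal P T
  minimal-below C = go C (⊂-wellFounded C)
    where
    go : ∀ C → Acc _⊂_ C → P C → ∃ λ T → T ⊆ C × Minimal P T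
    go C (acc smaller) pC with any? (λ x → x ∈? C ×-dec P? (C - x))
    ... | yes (x , x∈C , pC-x) =
      let T , T⊆C-x , minT = go (C - x) (smaller (x∈p⇒p-x⊂p x∈C)) pC-x
      in T , ⊆-trans T⊆C-x (p⊂q⇒p⊆q (x∈p⇒p-x⊂p x∈C)) , minT
    ... | no ∄deletable = C , (λ x∈C → x∈C) , pC , minC
      where
      minC : ∀ T' → T' ⊆ C → P T' → C ⊆ T'
      minC T' T'⊆C pT' {x} x∈C with x ∈? T'
      ... | yes x∈T' = x∈T'
      ... | no x∉T' = contradiction (x , x∈C , P-mono (p⊆q∧x∉p⇒p⊆q-x T'⊆C x∉T') pT') ∄deletable

ContainsEdge : Hypergraph m → Subset m → Set
ContainsEdge H B = ∃ λ e → H e × e ⊆ B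

Transversal-mono : (H : Hypergraph m) {T T' : Subset m} → T ⊆ T' → Transversal H T → Transversal H T'
Transversal-mono H T⊆T' transT e He =
  let j , j∈e , j∈T = transT e He in j , j∈e , T⊆T' j∈T

ContainsEdge⇒Transversal-tr : {H : Hypergraph m} {B : Subset m} → ContainsEdge H B → Transversal (tr H) B
ContainsEdge⇒Transversal-tr (e , He , e⊆B) T (transT , _) =
  let j , j∈e , j∈T = transT e He in j , j∈T , e⊆B j∈e

Transversal-tr⇒ContainsEdge : {H : Hypergraph m} {B : Subset m}
  → (∀ T → Dec (Transversal H T)) → Dec (ContainsEdge H B)
  → Transversal (tr H) B → ContainsEdge H B
Transversal-tr⇒ContainsEdge _ (yes edge) _ = edge
Transversal-tr⇒ContainsEdge {H = H} {B} Transversal? (no ∄edge) B-meets-trH =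
  let T , T⊆∁B , trT = minimal-below Transversal? (Transversal-mono H) (∁ B) ∁B-transversal
      j , j∈T , j∈B = B-meets-trH T trT
  in contradiction j∈B (x∈∁p⇒x∉p (T⊆∁B j∈T))
  where
  ∁B-transversal : Transversal H (∁ B)
  ∁B-transversal e He =
    let j , j∈e , j∉B = ⊈⇒∃∈∉ (λ e⊆B → ∄edge (e , He , e⊆B)) in j , j∈e , x∉p⇒x∈∁p j∉B

module _ (ℬ : Fin m → Subset n) (A : Subset n) where

  Transversal-ℋ? : ∀ T → Dec (Transversal (ℋ ℬ A) T)
  Transversal-ℋ? T = map′
    (λ { meets _ (x , x∈A , refl) → meets x x∈A })
    (λ transT x x∈A → transT (𝓑at ℬ x) (x , x∈A , refl))
    (all? λ x → x ∈? A →-dec any? λ j → j ∈? 𝓑at ℬ x ×-dec j ∈? T)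

  ContainsEdge-ℋ⇔ : ∀ {B} → ContainsEdge (ℋ ℬ A) B ⇔ (∃ λ x → x ∈ A × InS ℬ B x)
  ContainsEdge-ℋ⇔ = mk⇔
    (λ { (_ , (x , x∈A , refl) , 𝓑x⊆B) → x , x∈A , 𝓑x⊆B })
    (λ (x , x∈A , 𝓑x⊆B) → 𝓑at ℬ x , (x , x∈A , refl) , 𝓑x⊆B)

  ContainsEdge-ℋ? : ∀ B → Dec (ContainsEdge (ℋ ℬ A) B)
  ContainsEdge-ℋ? B = map′ (from ContainsEdge-ℋ⇔) (to ContainsEdge-ℋ⇔)
    (any? λ x → x ∈? A ×-dec 𝓑at ℬ x ⊆? B)

fHolds⇔Transversal-⋃trℋ : (𝒜 : Fin k → Subset n) (ℬ : Fin m → Subset n) {B : Subset m}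
  → fHolds 𝒜 ℬ B ⇔ Transversal (⋃trℋ 𝒜 ℬ) B
fHolds⇔Transversal-⋃trℋ 𝒜 ℬ {B} = mk⇔
  (λ f T (i , trT) → ContainsEdge⇒Transversal-tr (from (ContainsEdge-ℋ⇔ ℬ (𝒜 i)) (f i)) T trT)
  (λ transB i → to (ContainsEdge-ℋ⇔ ℬ (𝒜 i))
    (Transversal-tr⇒ContainsEdge (Transversal-ℋ? ℬ (𝒜 i)) (ContainsEdge-ℋ? ℬ (𝒜 i) B)
      (λ T trT → transB T (i , trT))))

proposition1 : (n m k : ℕ) (𝒜 : Fin k → Subset n) (ℬ : Fin m → Subset n)
    → Injective _≡_ _≡_ ℬ
    → (B : Subset m)
    → Minimal (fHolds 𝒜 ℬ) B ⇔ tr (⋃trℋ 𝒜 ℬ) B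
proposition1 n m k 𝒜 ℬ _ B = Minimal-resp-⇔ (fHolds⇔Transversal-⋃trℋ 𝒜 ℬ)
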